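{- Let $\mathcal{D}=(D,H_\mathcal{D},V_\mathcal{D})$ be a domino system. Then $\mathcal{D}$ admits a periodic tiling if and only if the formula $\varphi^{3\text{ -loc}}_{grid}\wedge\varphi_\mathcal{D}$ of $\mathrm{rdFO}[2,\Sigma_{grid}\uplus D,\{\sim_{(1,1)},\sim_{(2,2)}\},3]$ is satisfiable, i.e. some $2$-data structure over $\Sigma_{grid}\uplus D$ satisfies it.
   Context: Data structures and local logic. A $2$-data structure over a finite set $\Sigma$ of unary predicates is $\mathfrak{A}=(A,(P_\sigma)_{\sigma\in\Sigma},f_1,f_2)$ with $A$ nonempty finite, $P_\sigma\subseteq A$, $f_1,f_2:A\to\mathbb{N}$; $x\sim_{(i,j)}y$ means $f_i(x)=f_j(y)$. $\mathrm{dFO}[2,\Sigma,\Gamma]$ is first-order logic with atoms $\sigma(x)$, $x\sim y$ ($\sim\in\Gamma$), $x=y$. With $\Gamma=\{\sim_{(1,1)},\sim_{(2,2)}\}$, the data graph has vertices $A\times\{1,2\}$ and a directed edge $(a,i)\to(b,j)$ iff ($a=b$, $i\ne j$) or ($\sim_{(i,j)}\in\Gamma$ and $f_i(a)=f_j(b)$). $B_r(a)$ is the set of vertices at directed distance $\le r$ from $(a,1)$ or $(a,2)$. The $r$-view $\mathfrak{A}|^r_a$ has universe $\{b:(b,i)\in B_r(a)$ for some $i\}$, restricted predicates, and $i$-th value $f_i(b)$ if $(b,i)\in B_r(a)$, otherwise a fresh value (pairwise distinct, not among values of $\mathfrak{A}$). $\mathrm{rdFO}[2,\Sigma,\Gamma,r]$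 formulas: $\varphi::=\langle\psi\rangle^r_x\mid x=y\mid\exists x.\varphi\mid\varphi\vee\varphi\mid\neg\varphi$ with $\psi\in\mathrm{dFO}[2,\Sigma,\Gamma]$ having at most $x$ free; $\langle\psi\rangle^r_x$ holds at $I$ iff $\mathfrak{A}|^r_{I(x)}\models_I\psi$. Grids and dominoes. A bi-binary structure is $(A,R_1,R_2)$ with $A$ finite, $R_1,R_2\subseteq A\times A$; a morphism $\pi:(A,R_1,R_2)\to(A',R_1',R_2')$ maps $R_k$-pairs to $R_k'$-pairs. For $m\ge 1$, $\mathcal{G}_m=(\mathbb{Z}_m\times\mathbb{Z}_m,H_m,V_m)$ with $H_m=\{((i,j),(i',j)):i'-i\equiv1\bmod m\}$, $V_m=\{((i,j),(i,j')):j'-j\equiv 1\bmod m\}$. A domino system $\mathcal{D}=(D,H_\mathcal{D},V_\mathcal{D})$ has $D$ a finite set and $H_\mathcal{D},V_\mathcal{D}\subseteq D\times D$ (a bi-binary structure); a periodic tiling is a morphism $\mathcal{G}_m\to\mathcal{D}$ for some $m\ge1$. Elements of $D$ are also used as unary predicate symbols. Formulas. $\Sigma_{grid}=\{H_0,H_1,V_0,V_1\}$. $\varphi_H(x,y)$ is the disjunction of $H_0(x)\wedge H_1(y)\wedge V_0(x)\wedge V_0(y)\wedge x\sim_{(1,1)}y$; $H_1(x)\wedge H_0(y)\wedge V_0(x)\wedge V_0(y)\wedge x\sim_{(2,2)}y$; $H_0(x)\wedge H_1(y)\wedge V_1(x)\wedge V_1(y)\wedge x\sim_{(1,1)}y$;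 $H_1(x)\wedge H_0(y)\wedge V_1(x)\wedge V_1(y)\wedge x\sim_{(2,2)}y$. $\varphi_V(x,y)$ is the disjunction of $H_0(x)\wedge H_0(y)\wedge V_0(x)\wedge V_1(y)\wedge x\sim_{(1,1)}y$; $H_1(x)\wedge H_1(y)\wedge V_0(x)\wedge V_1(y)\wedge x\sim_{(1,1)}y$; $H_0(x)\wedge H_0(y)\wedge V_1(x)\wedge V_0(y)\wedge x\sim_{(2,2)}y$; $H_1(x)\wedge H_1(y)\wedge V_1(x)\wedge V_0(y)\wedge x\sim_{(2,2)}y$. $\varphi^{3\text{ -loc}}_{grid}=\forall x.\langle\forall y\forall x'\forall y'.(\varphi_H(x,y)\wedge\varphi_V(x,x')\wedge\varphi_V(y,y'))\to\varphi_H(x',y')\rangle^3_x\wedge\forall x.\langle\exists y.\varphi_H(x,y)\wedge\exists y.\varphi_V(x,y)\rangle^3_x\wedge\forall x.\langle(H_0(x)\oplus H_1(x))\wedge(V_0(x)\oplus V_1(x))\rangle^3_x$ ($\oplus$ is exclusive or). $\varphi_\mathcal{D}=\forall x.\langle\bigvee_{d\in D}\big(d(x)\wedge\bigwedge_{d\ne d'\in D}\neg(d(x)\wedge d'(x))\big)\rangle^3_x\wedge\forall x.\langle\forall y.\varphi_H(x,y)\to\bigvee_{(d,d')\in H_\mathcal{D}}d(x)\wedge d'(y)\rangle^3_x\wedge\forall x.\langle\forall y.\varphi_V(x,y)\to\bigvee_{(d,d')\in V_\mathcal{D}}d(x)\wedge d'(y)\rangle^3_x$. -}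

module Defs where

open import Data.Nat using (ℕ; zero; suc; _+_; _*_; _%_; _≡ᵇ_)
open import Data.Fin using (Fin; zero; suc; toℕ; _≟_)
open import Data.Fin.Properties using ()
open import Data.List using (List; []; _∷_; foldr; concatMap; map)
open import Data.Bool.ListAction using (any)
open import Data.Nat.ListAction using (sum)
open import Data.List.Base using (allFin)
open import Data.Bool using (Bool; true; false; T; _∧_; _∨_; if_then_else_; not)
open import Data.Product using (Σ; _×_; _,_; proj₁; proj₂)
open import Data.Sum using (_⊎_)
open import Relation.Nullary using (¬_; does)
open import Relation.Binary.PropositionalEquality using (_≡_)

-- 2-data structures over a (finite) set Pred of unary predicate symbols.
-- Universe A = Fin (suc size)  (nonempty, finite).

record DataStr (Pred : Set) : Set where
  field
    size : ℕ
    P    : Pred → Fin (suc size) → Bool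
    f₁   : Fin (suc size) → ℕ
    f₂   : Fin (suc size) → ℕ

-- f_i, with i ∈ Fin 2 (zero ↦ 1, suc zero ↦ 2)
val : ∀ {Pred} (𝔄 : DataStr Pred) → Fin 2 → Fin (suc (DataStr.size 𝔄)) → ℕ
val 𝔄 zero    = DataStr.f₁ 𝔄
val 𝔄 (suc _) = DataStr.f₂ 𝔄

-- Γ ⊆ {1,2}×{1,2}, given by its characteristic function: ∼(i,j) ∈ Γ iff T (Γ i j)
DataRels : Set
DataRels = Fin 2 → Fin 2 → Bool

Var : Set
Var = ℕ

data dFO (Pred : Set) (Γ : DataRels) : Set where
  atom : Pred → Var → dFO Pred Γ
  sim  : (i j : Fin 2) → T (Γ i j) → Var → Var → dFO Pred Γ
  eq   : Var → Var → dFO Pred Γ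
  ex   : Var → dFO Pred Γ → dFO Pred Γ
  or   : dFO Pred Γ → dFO Pred Γ → dFO Pred Γ
  neg  : dFO Pred Γ → dFO Pred Γ

-- Semantics of dFO in a structure on universe {b ∈ Fin n | dom b}
-- with predicates P and data values v (v i = f_{i+1}), under assignment I.
evalD : ∀ {Pred Γ} (n : ℕ) (dom : Fin n → Bool) (P : Pred → Fin n → Bool)
        (v : Fin 2 → Fin n → ℕ) (I : Var → Fin n) → dFO Pred Γ → Set
evalD n dom P v I (atom σ x)    = T (P σ (I x))
evalD n dom P v I (sim i j _ x y) = v i (I x) ≡ v j (I y)
evalD n dom P v I (eq x y)      = I x ≡ I y
evalD n dom P v I (ex x φ)      =
  Σ (Fin n) λ b → T (dom b) × evalD n dom P v (λ z → if z ≡ᵇ x then b else I z) φ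
evalD n dom P v I (or φ ψ)      = evalD n dom P v I φ ⊎ evalD n dom P v I ψ
evalD n dom P v I (neg φ)       = ¬ evalD n dom P v I φ

Vertex : ℕ → Set
Vertex n = Fin n × Fin 2

vertices : (n : ℕ) → List (Vertex n)
vertices n = concatMap (λ b → (b , zero) ∷ (b , suc zero) ∷ []) (allFin n)

eqFin : ∀ {n} → Fin n → Fin n → Bool
eqFin a b = does (a ≟ b)

eqV : ∀ {n} → Vertex n → Vertex n → Bool
eqV (a , i) (b , j) = eqFin a b ∧ eqFin i j

edge : ∀ {Pred} (Γ : DataRels) (𝔄 : DataStr Pred) →
       Vertex (suc (DataStr.size 𝔄)) → Vertex (suc (DataStr.size 𝔄)) → Bool
edge Γ 𝔄 (a , i) (b , j) =
  (eqFin a b ∧ not (eqFin i j)) ∨ (Γ i j ∧ (val 𝔄 i a ≡ᵇ val 𝔄 j b))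

reach : ∀ {Pred} (Γ : DataRels) (𝔄 : DataStr Pred) → ℕ →
        Vertex (suc (DataStr.size 𝔄)) → Vertex (suc (DataStr.size 𝔄)) → Bool
reach Γ 𝔄 zero    u w = eqV u w
reach Γ 𝔄 (suc r) u w =
  reach Γ 𝔄 r u w ∨ any (λ z → reach Γ 𝔄 r u z ∧ edge Γ 𝔄 z w) (vertices _)

inBall : ∀ {Pred} (Γ : DataRels) (𝔄 : DataStr Pred) (r : ℕ) →
         Fin (suc (DataStr.size 𝔄)) → Vertex (suc (DataStr.size 𝔄)) → Bool
inBall Γ 𝔄 r a w = reach Γ 𝔄 r (a , zero) w ∨ reach Γ 𝔄 r (a , suc zero) w

-- The r-view 𝔄|^r_a  (universe: elements of A carried as a subset via `viewDom`)

valBound : ∀ {Pred} (𝔄 : DataStr Pred) → ℕ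
valBound 𝔄 = sum (map (λ b → DataStr.f₁ 𝔄 b + DataStr.f₂ 𝔄 b) (allFin _))

-- fresh values: pairwise distinct (injective in (b,i)) and larger than every value of 𝔄
fresh : ∀ {Pred} (𝔄 : DataStr Pred) → Fin 2 → Fin (suc (DataStr.size 𝔄)) → ℕ
fresh 𝔄 i b = suc (valBound 𝔄) + (2 * toℕ b + toℕ i)

viewDom : ∀ {Pred} (Γ : DataRels) (𝔄 : DataStr Pred) (r : ℕ) →
          Fin (suc (DataStr.size 𝔄)) → Fin (suc (DataStr.size 𝔄)) → Bool
viewDom Γ 𝔄 r a b = inBall Γ 𝔄 r a (b , zero) ∨ inBall Γ 𝔄 r a (b , suc zero)

viewVal : ∀ {Pred} (Γ : DataRels) (𝔄 : DataStr Pred) (r : ℕ) →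
          Fin (suc (DataStr.size 𝔄)) → Fin 2 → Fin (suc (DataStr.size 𝔄)) → ℕ
viewVal Γ 𝔄 r a i b = if inBall Γ 𝔄 r a (b , i) then val 𝔄 i b else fresh 𝔄 i b

viewSat : ∀ {Pred Γ} (𝔄 : DataStr Pred) (r : ℕ) (a : Fin (suc (DataStr.size 𝔄)))
          (I : Var → Fin (suc (DataStr.size 𝔄))) → dFO Pred Γ → Set
viewSat {Γ = Γ} 𝔄 r a I ψ =
  evalD _ (viewDom Γ 𝔄 r a) (DataStr.P 𝔄) (viewVal Γ 𝔄 r a) I ψ

-- Syntax and semantics of rdFO[2, Pred, Γ, r]
-- (the side condition "ψ has at most x free" in ⟨ψ⟩^r_x is not enforced
--  syntactically; all formulas used below satisfy it)

data rdFO (Pred : Set) (Γ : DataRels) (r : ℕ) : Set where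
  loc : dFO Pred Γ → Var → rdFO Pred Γ r
  eq  : Var → Var → rdFO Pred Γ r
  ex  : Var → rdFO Pred Γ r → rdFO Pred Γ r
  or  : rdFO Pred Γ r → rdFO Pred Γ r → rdFO Pred Γ r
  neg : rdFO Pred Γ r → rdFO Pred Γ r

evalR : ∀ {Pred Γ r} (𝔄 : DataStr Pred) (I : Var → Fin (suc (DataStr.size 𝔄))) →
        rdFO Pred Γ r → Set
evalR {r = r} 𝔄 I (loc ψ x) = viewSat 𝔄 r (I x) I ψ
evalR 𝔄 I (eq x y)  = I x ≡ I y
evalR 𝔄 I (ex x φ)  = Σ (Fin _) λ b → evalR 𝔄 (λ z → if z ≡ᵇ x then b else I z) φ
evalR 𝔄 I (or φ ψ)  = evalR 𝔄 I φ ⊎ evalR 𝔄 I ψ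
evalR 𝔄 I (neg φ)   = ¬ evalR 𝔄 I φ

-- 𝔄 ⊨ φ for a sentence φ (the assignment is irrelevant; we use the constant one)
_⊨_ : ∀ {Pred Γ r} (𝔄 : DataStr Pred) → rdFO Pred Γ r → Set
𝔄 ⊨ φ = evalR 𝔄 (λ _ → zero) φ

Satisfiable : ∀ {Pred Γ r} → rdFO Pred Γ r → Set
Satisfiable {Pred} φ = Σ (DataStr Pred) λ 𝔄 → 𝔄 ⊨ φ

module Connectives {Pred : Set} {Γ : DataRels} where
  infixr 6 _∧'_
  infixr 5 _∨'_
  infixr 4 _⇒'_
  _∨'_ : dFO Pred Γ → dFO Pred Γ → dFO Pred Γ
  _∨'_ = or
  _∧'_ : dFO Pred Γ → dFO Pred Γ → dFO Pred Γ
  φ ∧' ψ = neg (or (neg φ) (neg ψ))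
  _⇒'_ : dFO Pred Γ → dFO Pred Γ → dFO Pred Γ
  φ ⇒' ψ = or (neg φ) ψ
  _⊕'_ : dFO Pred Γ → dFO Pred Γ → dFO Pred Γ
  φ ⊕' ψ = (φ ∧' neg ψ) ∨' (neg φ ∧' ψ)
  all' : Var → dFO Pred Γ → dFO Pred Γ
  all' x φ = neg (ex x (neg φ))
  true' : dFO Pred Γ
  true' = eq 0 0
  false' : dFO Pred Γ
  false' = neg true'
  ⋁ : List (dFO Pred Γ) → dFO Pred Γ
  ⋁ = foldr _∨'_ false'
  ⋀ : List (dFO Pred Γ) → dFO Pred Γ
  ⋀ = foldr _∧'_ true'

module RConnectives {Pred : Set} {Γ : DataRels} {r : ℕ} where
  _∧ʳ_ : rdFO Pred Γ r → rdFO Pred Γ r → rdFO Pred Γ r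
  φ ∧ʳ ψ = neg (or (neg φ) (neg ψ))
  allʳ : Var → rdFO Pred Γ r → rdFO Pred Γ r
  allʳ x φ = neg (ex x (neg φ))

record BiBinary : Set₁ where
  field
    Carrier : Set
    R₁ R₂   : Carrier → Carrier → Set

record Morphism (𝒜 𝒜' : BiBinary) : Set where
  field
    π     : BiBinary.Carrier 𝒜 → BiBinary.Carrier 𝒜'
    pres₁ : ∀ a b → BiBinary.R₁ 𝒜 a b → BiBinary.R₁ 𝒜' (π a) (π b)
    pres₂ : ∀ a b → BiBinary.R₂ 𝒜 a b → BiBinary.R₂ 𝒜' (π a) (π b)

-- 𝒢_m for m = suc m' ≥ 1, with ℤ_m represented by Fin m
Grid : (m' : ℕ) → BiBinary
Grid m' = record
  { Carrier = Fin (suc m') × Fin (suc m')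
  ; R₁ = λ { (i , j) (i' , j') → (toℕ i' ≡ (suc (toℕ i)) % suc m') × (j' ≡ j) }
  ; R₂ = λ { (i , j) (i' , j') → (i' ≡ i) × (toℕ j' ≡ (suc (toℕ j)) % suc m') }
  }

record DominoSystem : Set where
  field
    k  : ℕ
    HD : Fin k → Fin k → Bool
    VD : Fin k → Fin k → Bool

asBiBinary : DominoSystem → BiBinary
asBiBinary 𝒟 = record
  { Carrier = Fin (DominoSystem.k 𝒟)
  ; R₁ = λ d d' → T (DominoSystem.HD 𝒟 d d')
  ; R₂ = λ d d' → T (DominoSystem.VD 𝒟 d d')
  }

HasPeriodicTiling : DominoSystem → Set
HasPeriodicTiling 𝒟 = Σ ℕ λ m' → Morphism (Grid m') (asBiBinary 𝒟)

data GridPred : Set where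
  H₀ H₁ V₀ V₁ : GridPred

PredD : DominoSystem → Set
PredD 𝒟 = GridPred ⊎ Fin (DominoSystem.k 𝒟)

Γ₀ : DataRels
Γ₀ i j = eqFin i j

module Formulas (𝒟 : DominoSystem) where
  open DominoSystem 𝒟
  open Connectives {PredD 𝒟} {Γ₀}
  open RConnectives {PredD 𝒟} {Γ₀} {3}
  open import Data.Sum using (inj₁; inj₂)

  F : Set
  F = dFO (PredD 𝒟) Γ₀

  g : GridPred → Var → F
  g p = atom (inj₁ p)

  dom' : Fin k → Var → F
  dom' d = atom (inj₂ d)

  _∼₁₁_ _∼₂₂_ : Var → Var → F
  x ∼₁₁ y = sim zero zero _ x y
  x ∼₂₂ y = sim (suc zero) (suc zero) _ x y

  vx vy vx' vy' : Var
  vx = 0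
  vy = 1
  vx' = 2
  vy' = 3

  φH : Var → Var → F
  φH x y =
       (g H₀ x ∧' g H₁ y ∧' g V₀ x ∧' g V₀ y ∧' x ∼₁₁ y)
    ∨' (g H₁ x ∧' g H₀ y ∧' g V₀ x ∧' g V₀ y ∧' x ∼₂₂ y)
    ∨' (g H₀ x ∧' g H₁ y ∧' g V₁ x ∧' g V₁ y ∧' x ∼₁₁ y)
    ∨' (g H₁ x ∧' g H₀ y ∧' g V₁ x ∧' g V₁ y ∧' x ∼₂₂ y)

  φV : Var → Var → F
  φV x y =
       (g H₀ x ∧' g H₀ y ∧' g V₀ x ∧' g V₁ y ∧' x ∼₁₁ y)
    ∨' (g H₁ x ∧' g H₁ y ∧' g V₀ x ∧' g V₁ y ∧' x ∼₁₁ y)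
    ∨' (g H₀ x ∧' g H₀ y ∧' g V₁ x ∧' g V₀ y ∧' x ∼₂₂ y)
    ∨' (g H₁ x ∧' g H₁ y ∧' g V₁ x ∧' g V₀ y ∧' x ∼₂₂ y)

  R : Set
  R = rdFO (PredD 𝒟) Γ₀ 3

  φgrid3loc : R
  φgrid3loc =
        allʳ vx (loc (all' vy (all' vx' (all' vy'
                   ((φH vx vy ∧' φV vx vx' ∧' φV vy vy') ⇒' φH vx' vy')))) vx)
    ∧ʳ (allʳ vx (loc (ex vy (φH vx vy) ∧' ex vy (φV vx vy)) vx)
    ∧ʳ  allʳ vx (loc ((g H₀ vx ⊕' g H₁ vx) ∧' (g V₀ vx ⊕' g V₁ vx)) vx))

  pairsDisj : (Fin k → Fin k → Bool) → Var → Var → F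
  pairsDisj rel x y =
    ⋁ (concatMap (λ d → concatMap (λ d' →
          if rel d d' then (dom' d x ∧' dom' d' y) ∷ [] else []) (allFin k)) (allFin k))

  φD : R
  φD =
        allʳ vx (loc (⋁ (map (λ d → dom' d vx ∧'
                   ⋀ (concatMap (λ d' → if eqFin d d' then []
                                        else neg (dom' d vx ∧' dom' d' vx) ∷ [])
                                (allFin k)))
                   (allFin k))) vx)
    ∧ʳ (allʳ vx (loc (all' vy (φH vx vy ⇒' pairsDisj HD vx vy)) vx)
    ∧ʳ  allʳ vx (loc (all' vy (φV vx vy ⇒' pairsDisj VD vx vy)) vx))

  φgridD : R
  φgridD = φgrid3loc ∧ʳ φD

module Submission where

-- The 3-local formula only looks at the 3-view around each element, but every element it
-- relates to the centre (its H- and V-neighbours and one further V-step) lies in that view,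
-- and the data values compared there are the true ones, while all other values are fresh.
-- So 𝔄 satisfies φgridD exactly when the relations H and V read off φH and φV are total,
-- close commuting squares and carry a domino tiling respecting H_𝒟 and V_𝒟.  On an
-- n-element structure, iterating chosen H- and V-successors n times reaches cycles whose
-- lengths divide n!, which gives a morphism from the torus 𝒢_{n!}.  Conversely a tiling of
-- 𝒢_m is realised on (ℤ₂ × ℤ_m)²: each coordinate carries a parity that flips at every
-- step, and consecutive elements share the data value indexed by the parity of the first.

open import Defs

open import Data.Bool using (Bool; true; false; T; not; _∧_; if_then_else_)
open import Data.Bool.Properties using (T?; T-∧; T-∨)
open import Data.Empty using (⊥-elim)
open import Data.Fin as Fin using (Fin; zero; suc; toℕ)
import Data.Fin.Properties as Finₚ
open import Data.List using (List; []; _∷_; map; concatMap; allFin)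
open import Data.List.Membership.Propositional using (_∈_)
open import Data.List.Membership.Propositional.Properties using (∈-map⁺; ∈-allFin)
open import Data.List.Relation.Unary.All using (All; []; _∷_)
import Data.List.Relation.Unary.All.Properties as Allₚ
open import Data.List.Relation.Unary.Any as Any using (Any; here; there)
import Data.List.Relation.Unary.Any.Properties as Anyₚ
open import Data.Nat as ℕ using (ℕ; zero; suc; _+_; _*_; _∸_; _!; _≡ᵇ_)
open import Data.Nat.Divisibility using (_∣_; divides; ∣-trans; m∣m*n; m≤n⇒m!∣n!)
open import Data.Nat.DivMod
  using (_%_; _/_; m≡m%n+[m/n]*n; m%n<n; m<n⇒m%n≡m; [m+n]%n≡m%n; %-distribˡ-+)
open import Data.Nat.GeneralisedArithmetic using (fold; fold-+)
open import Data.Nat.ListAction using (sum)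
import Data.Nat.Properties as ℕₚ
open import Data.Product as Product using (∃; ∃₂; ∃!; _×_; _,_; proj₁; proj₂)
open import Data.Product.Function.NonDependent.Propositional using (_×-⇔_)
open import Data.Sum as Sum using (_⊎_; inj₁; inj₂; [_,_])
open import Data.Sum.Function.Propositional using (_⊎-⇔_)
open import Function using (_∘_)
open import Function.Bundles using (_⇔_; mk⇔; Equivalence)
open import Function.Construct.Identity using (⇔-id)
open import Function.Properties.Equivalence using () renaming (trans to ⇔-trans)
open import Function.Properties.Inverse using (↔⇒⇔)
open import Relation.Nullary using (¬_; Dec; yes; no; ¬?)
open import Relation.Nullary.Decidable using (_×-dec_; _⊎-dec_; decidable-stable)
open import Relation.Nullary.Negation using (Stable; negated-stable)
open import Relation.Binary.PropositionalEquality
  using (_≡_; _≢_; refl; sym; trans; cong; cong₂; subst; subst₂; module ≡-Reasoning)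

open Equivalence using (to; from)

infixr 1 _⊻_
_⊻_ : Set → Set → Set
A ⊻ B = (A × ¬ B) ⊎ (¬ A × B)

module _ {A B : Set} where

  ¬⊎¬⇔× : Stable A → Stable B → (¬ (¬ A ⊎ ¬ B)) ⇔ (A × B)
  ¬⊎¬⇔× sA sB = mk⇔ (λ h → sA (h ∘ inj₁) , sB (h ∘ inj₂))
                    (λ (a , b) → [ (λ ¬a → ¬a a) , (λ ¬b → ¬b b) ])

  ¬⊎⇔→ : Dec A → (¬ A ⊎ B) ⇔ (A → B)
  ¬⊎⇔→ a? = mk⇔ [ (λ ¬a a → ⊥-elim (¬a a)) , (λ b _ → b) ] (to⊎ a?)
    where
    to⊎ : Dec A → (A → B) → ¬ A ⊎ B
    to⊎ (yes a) f = inj₂ (f a)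
    to⊎ (no ¬a) _ = inj₁ ¬a

¬-cong : ∀ {A A' : Set} → A ⇔ A' → (¬ A) ⇔ (¬ A')
¬-cong e = mk⇔ (λ ¬a a' → ¬a (from e a')) (λ ¬a' a → ¬a' (to e a))

⊻-cong : ∀ {A A' B B' : Set} → A ⇔ A' → B ⇔ B' → (A ⊻ B) ⇔ (A' ⊻ B')
⊻-cong f g = (f ×-⇔ ¬-cong g) ⊎-⇔ (¬-cong f ×-⇔ g)

→-cong : ∀ {A A' B B' : Set} → A ⇔ A' → B ⇔ B' → (A → B) ⇔ (A' → B')
→-cong f g = mk⇔ (λ h → to g ∘ h ∘ from f) (λ h → from g ∘ h ∘ to f)

module _ {X : Set} {Q : X → Set} where

  exclusive⇔∃! : (∀ (x y : X) → Dec (x ≡ y)) →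
                 (∃ λ x → Q x × ∀ y → x ≢ y → ¬ (Q x × Q y)) ⇔ ∃! _≡_ Q
  exclusive⇔∃! _≟_ = mk⇔
    (λ (x , q , excl) → x , q , λ {y} q' → decidable-stable (x ≟ y) (λ x≢y → excl y x≢y (q , q')))
    (λ (x , q , unique) → x , q , λ y x≢y (_ , q') → x≢y (unique q'))

module _ {X : Set} {Q R : X → Set} where

  ∃-cong : (∀ {x} → Q x ⇔ R x) → ∃ Q ⇔ ∃ R
  ∃-cong e = mk⇔ (λ (x , q) → x , to (e {x}) q) (λ (x , r) → x , from (e {x}) r)

  ∀-cong : (∀ x → Q x ⇔ R x) → (∀ x → Q x) ⇔ (∀ x → R x)
  ∀-cong e = mk⇔ (λ q x → to (e x) (q x)) (λ r x → from (e x) (r x))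

  ¬∃¬⇔∀ : (∀ x → Stable (R x)) → (¬ ∃ λ x → Q x × ¬ R x) ⇔ (∀ x → Q x → R x)
  ¬∃¬⇔∀ s = mk⇔ (λ h x q → s x (λ ¬r → h (x , q , ¬r))) (λ f (x , q , ¬r) → ¬r (f x q))

module _ {X Y : Set} {Q : Y → Set} where

  Any-concatMap : ∀ {f : X → List Y} {xs} → Any Q (concatMap f xs) ⇔ Any (Any Q ∘ f) xs
  Any-concatMap = mk⇔ (Anyₚ.concatMap⁻ _) (Anyₚ.concatMap⁺ _)

  All-concatMap : ∀ {f : X → List Y} {xs} → All Q (concatMap f xs) ⇔ All (All Q ∘ f) xs
  All-concatMap = mk⇔ (Allₚ.map⁻ ∘ Allₚ.concat⁻) (Allₚ.concat⁺ ∘ Allₚ.map⁺)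

module _ {n : ℕ} {Q : Fin n → Set} where

  Any-allFin : Any Q (allFin n) ⇔ ∃ Q
  Any-allFin = mk⇔ Anyₚ.tabulate⁻ (λ (i , q) → Anyₚ.tabulate⁺ i q)

  All-allFin : All Q (allFin n) ⇔ (∀ i → Q i)
  All-allFin = mk⇔ Allₚ.tabulate⁻ Allₚ.tabulate⁺

module _ {X : Set} {Q : X → Set} {x : X} where

  Any-singleton-if : ∀ b → Any Q (if b then x ∷ [] else []) ⇔ (T b × Q x)
  Any-singleton-if true  = mk⇔ (λ { (here q) → _ , q ; (there ()) }) (here ∘ proj₂)
  Any-singleton-if false = mk⇔ (λ ()) (λ ())

  All-singleton-unless : ∀ b → All Q (if b then [] else x ∷ []) ⇔ (¬ T b → Q x)
  All-singleton-unless true  = mk⇔ (λ _ ¬t → ⊥-elim (¬t _)) (λ _ → [])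
  All-singleton-unless false = mk⇔ (λ { (q ∷ []) _ → q }) (λ f → f (λ ()) ∷ [])

T-eqFin : ∀ {n} {a b : Fin n} → T (eqFin a b) ⇔ a ≡ b
T-eqFin {a = a} {b} with a Fin.≟ b
... | yes a≡b = mk⇔ (λ _ → a≡b) _
... | no a≢b  = mk⇔ (λ ()) a≢b

eqFin-refl : ∀ {n} (a : Fin n) → T (eqFin a a)
eqFin-refl a = from (T-eqFin {a = a}) refl

∈⇒≤sum : ∀ {m ms} → m ∈ ms → m ℕ.≤ sum ms
∈⇒≤sum {ms = m ∷ _}  (here refl) = ℕₚ.m≤m+n m _
∈⇒≤sum {ms = m' ∷ _} (there m∈) = ℕₚ.≤-trans (∈⇒≤sum m∈) (ℕₚ.m≤n+m _ m')

toggle : Fin 2 → Fin 2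
toggle zero       = suc zero
toggle (suc zero) = zero

toggle-≢ : ∀ {i j} → i ≢ j → toggle i ≡ j
toggle-≢ {zero}     {zero}     i≢j = ⊥-elim (i≢j refl)
toggle-≢ {zero}     {suc zero} _   = refl
toggle-≢ {suc zero} {zero}     _   = refl
toggle-≢ {suc zero} {suc zero} i≢j = ⊥-elim (i≢j refl)

iter : ∀ {X : Set} → (X → X) → ℕ → X → X
iter f n x = fold x f n

module _ {X : Set} (f : X → X) where

  iter-+ : ∀ m n x → iter f (m + n) x ≡ iter f m (iter f n x)
  iter-+ m n x = fold-+ x f m

  iter-comm : ∀ m n x → iter f m (iter f n x) ≡ iter f n (iter f m x)
  iter-comm m n x = begin
    iter f m (iter f n x)  ≡⟨ iter-+ m n x ⟨
    iter f (m + n) x       ≡⟨ cong (λ l → iter f l x) (ℕₚ.+-comm m n) ⟩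
    iter f (n + m) x       ≡⟨ iter-+ n m x ⟩
    iter f n (iter f m x)  ∎
    where open ≡-Reasoning

  module _ {p : ℕ} {y : X} (cycle : iter f p y ≡ y) where

    iter-cycle : ∀ c → iter f (c * p) y ≡ y
    iter-cycle zero    = refl
    iter-cycle (suc c) = trans (iter-+ p (c * p) y) (trans (cong (iter f p) (iter-cycle c)) cycle)

    iter-shift : ∀ i → iter f (i + p) y ≡ iter f i y
    iter-shift i = trans (iter-+ i p y) (cong (iter f i) cycle)

0<m≤n⇒m∣n! : ∀ {m n} → 0 ℕ.< m → m ℕ.≤ n → m ∣ n !
0<m≤n⇒m∣n! {suc m} _ m≤n = ∣-trans (m∣m*n (m !)) (m≤n⇒m!∣n! m≤n)

-- By pigeonhole the orbit of x repeats within n steps, with a period q ≤ n, and q divides n!.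
iter-fin-period : ∀ {n} (f : Fin n → Fin n) x → iter f (n !) (iter f n x) ≡ iter f n x
iter-fin-period {n} f x
  with i , j , i<j , fᵢ≡fⱼ ← Finₚ.pigeonhole (ℕₚ.n<1+n n) (λ i → iter f (toℕ i) x) = begin
    iter f (n !) (iter f n x)        ≡⟨ cong (iter f (n !)) n-split ⟩
    iter f (n !) (iter f (n ∸ p) z)  ≡⟨ iter-comm f (n !) (n ∸ p) z ⟩
    iter f (n ∸ p) (iter f (n !) z)  ≡⟨ cong (iter f (n ∸ p)) z-periodic ⟩
    iter f (n ∸ p) z                 ≡⟨ n-split ⟨
    iter f n x                       ∎
  where
  open ≡-Reasoning
  p q : ℕ
  p = toℕ i
  q = toℕ j ∸ p
  z : Fin n
  z = iter f p x

  j≡q+p : toℕ j ≡ q + p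
  j≡q+p = sym (ℕₚ.m∸n+n≡m (ℕₚ.<⇒≤ i<j))

  cycle : iter f q z ≡ z
  cycle = trans (sym (iter-+ f q p x)) (trans (cong (λ l → iter f l x) (sym j≡q+p)) (sym fᵢ≡fⱼ))

  z-periodic : iter f (n !) z ≡ z
  z-periodic with divides c n!≡c*q ← 0<m≤n⇒m∣n! (ℕₚ.m<n⇒0<n∸m i<j)
                                        (ℕₚ.≤-trans (ℕₚ.m∸n≤m (toℕ j) p) (ℕ.s≤s⁻¹ (Finₚ.toℕ<n j)))
    = trans (cong (λ l → iter f l z) n!≡c*q) (iter-cycle f cycle c)

  n-split : iter f n x ≡ iter f (n ∸ p) z
  n-split = trans (cong (λ l → iter f l x) (sym (ℕₚ.m∸n+n≡m p≤n))) (iter-+ f (n ∸ p) p x)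
    where
    p≤n : p ℕ.≤ n
    p≤n = ℕ.s≤s⁻¹ (ℕₚ.<-trans i<j (Finₚ.toℕ<n j))

mod-invariant : ∀ {X : Set} M .{{_ : ℕ.NonZero M}} (h : ℕ → X) →
                (∀ i → h (i + M) ≡ h i) → ∀ i → h (i % M) ≡ h i
mod-invariant M h shift i = sym (trans (cong h (m≡m%n+[m/n]*n i M)) (multiples (i % M) (i / M)))
  where
  multiples : ∀ j c → h (j + c * M) ≡ h j
  multiples j zero    = cong h (ℕₚ.+-identityʳ j)
  multiples j (suc c) = begin
    h (j + (M + c * M))  ≡⟨ cong (λ l → h (j + l)) (ℕₚ.+-comm M (c * M)) ⟩
    h (j + (c * M + M))  ≡⟨ cong h (ℕₚ.+-assoc j (c * M) M) ⟨
    h (j + c * M + M)    ≡⟨ shift (j + c * M) ⟩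
    h (j + c * M)        ≡⟨ multiples j c ⟩
    h j                  ∎
    where open ≡-Reasoning

_∘ₘ_ : ∀ {𝒜 ℬ 𝒞} → Morphism ℬ 𝒞 → Morphism 𝒜 ℬ → Morphism 𝒜 𝒞
σ ∘ₘ τ = record
  { π     = Morphism.π σ ∘ Morphism.π τ
  ; pres₁ = λ a b r → Morphism.pres₁ σ _ _ (Morphism.pres₁ τ a b r)
  ; pres₂ = λ a b r → Morphism.pres₂ σ _ _ (Morphism.pres₂ τ a b r)
  }

module _ {n : ℕ} {R₁ R₂ : Fin (suc n) → Fin (suc n) → Set}
         (total₁ : ∀ x → ∃ (R₁ x)) (total₂ : ∀ x → ∃ (R₂ x))
         (square : ∀ {x y x' y'} → R₁ x y → R₂ x x' → R₂ y y' → R₁ x' y') where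

  private
    N : ℕ
    N = suc n

    right up : Fin N → Fin N
    right = proj₁ ∘ total₁
    up    = proj₁ ∘ total₂

    m' : ℕ
    m' = ℕ.pred (N !)

    period : ∀ (f : Fin N → Fin N) x → iter f (suc m') (iter f N x) ≡ iter f N x
    period f x = subst (λ l → iter f l (iter f N x) ≡ iter f N x)
                       (sym (ℕₚ.suc-pred (N !) {{ℕₚ._!≢0 N}})) (iter-fin-period f x)

    -- rows and columns start N steps in, where every orbit is already periodic
    cell : ℕ → ℕ → Fin N
    cell i j = iter up j (iter up N (iter right i (iter right N zero)))

    cellAt : Fin (suc m') × Fin (suc m') → Fin N
    cellAt (i , j) = cell (toℕ i) (toℕ j)

    R₁-up : ∀ l {x y} → R₁ x y → R₁ (iter up l x) (iter up l y)
    R₁-up zero    r = r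
    R₁-up (suc l) r = square (R₁-up l r) (proj₂ (total₂ _)) (proj₂ (total₂ _))

    cell-mod-i : ∀ i j → cell (i % suc m') j ≡ cell i j
    cell-mod-i i j = mod-invariant (suc m') (λ i → cell i j)
      (λ i → cong (iter up j ∘ iter up N) (iter-shift right (period right zero) i)) i

    cell-mod-j : ∀ i j → cell i (j % suc m') ≡ cell i j
    cell-mod-j i = mod-invariant (suc m') (cell i) (iter-shift up (period up _))

  squares⇒grid-morphism :
    ∃ λ m' → Morphism (Grid m') (record { Carrier = Fin N ; R₁ = R₁ ; R₂ = R₂ })
  squares⇒grid-morphism = m' , record { π = cellAt ; pres₁ = pres₁ ; pres₂ = pres₂ }
    where
    pres₁ : ∀ a b → BiBinary.R₁ (Grid m') a b → R₁ (cellAt a) (cellAt b)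
    pres₁ (i , j) (i' , _) (i'≡1+i , refl) =
      subst (R₁ _) (trans (sym (cell-mod-i (suc (toℕ i)) (toℕ j)))
                          (cong (λ l → cell l (toℕ j)) (sym i'≡1+i)))
            (R₁-up (toℕ j) (R₁-up N (proj₂ (total₁ _))))

    pres₂ : ∀ a b → BiBinary.R₂ (Grid m') a b → R₂ (cellAt a) (cellAt b)
    pres₂ (i , j) (_ , j') (refl , j'≡1+j) =
      subst (R₂ _) (trans (sym (cell-mod-j (toℕ i) (suc (toℕ j)))) (cong (cell (toℕ i)) (sym j'≡1+j)))
            (proj₂ (total₂ _))

_[_↦_] : ∀ {n} → (Var → Fin n) → Var → Fin n → Var → Fin n
(I [ x ↦ b ]) z = if z ≡ᵇ x then b else I z

module Satisfaction {Pred : Set} {Γ : DataRels} (n : ℕ) (dom : Fin n → Bool)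
                    (P : Pred → Fin n → Bool) (v : Fin 2 → Fin n → ℕ) where
  open Connectives {Pred} {Γ}

  Sat : (Var → Fin n) → dFO Pred Γ → Set
  Sat = evalD {Pred} {Γ} n dom P v

  -- A record, so that I and φ are determined by the type of a proof: evalD is not injective.
  record Holds (I : Var → Fin n) (φ : dFO Pred Γ) : Set where
    constructor holds
    field evidence : Sat I φ

  holds? : ∀ I φ → Dec (Sat I φ)
  holds? I (atom σ x)      = T? (P σ (I x))
  holds? I (sim i j _ x y) = v i (I x) ℕ.≟ v j (I y)
  holds? I (eq x y)        = I x Fin.≟ I y
  holds? I (ex x φ)        = Finₚ.any? λ b → T? (dom b) ×-dec holds? (I [ x ↦ b ]) φ
  holds? I (or φ ψ)        = holds? I φ ⊎-dec holds? I ψ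
  holds? I (neg φ)         = ¬? (holds? I φ)

  stable : ∀ I φ → Stable (Sat I φ)
  stable I φ = decidable-stable (holds? I φ)

  private variable
    I : Var → Fin n
    φ ψ : dFO Pred Γ

  ¬¬-holds : (¬ ¬ Sat I φ) ⇔ Holds I φ
  ¬¬-holds {I} {φ} = mk⇔ (λ ¬¬s → holds (stable I φ ¬¬s)) (λ (holds s) ¬s → ¬s s)

  ∧-holds : Holds I (φ ∧' ψ) ⇔ (Holds I φ × Holds I ψ)
  ∧-holds {I} {φ} {ψ} = mk⇔
    (λ (holds h) → let a , b = to (¬⊎¬⇔× (stable I φ) (stable I ψ)) h in holds a , holds b)
    (λ (holds a , holds b) → holds (from (¬⊎¬⇔× (stable I φ) (stable I ψ)) (a , b)))

  ⇒-holds : Holds I (φ ⇒' ψ) ⇔ (Holds I φ → Holds I ψ)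
  ⇒-holds {I} {φ} = mk⇔
    (λ (holds h) (holds a) → holds (to (¬⊎⇔→ (holds? I φ)) h a))
    (λ f → holds (from (¬⊎⇔→ (holds? I φ)) (Holds.evidence ∘ f ∘ holds)))

  atom-holds : ∀ {σ x} → Holds I (atom σ x) ⇔ T (P σ (I x))
  atom-holds = mk⇔ Holds.evidence holds

  ∨-holds : Holds I (φ ∨' ψ) ⇔ (Holds I φ ⊎ Holds I ψ)
  ∨-holds = mk⇔ (λ { (holds (inj₁ a)) → inj₁ (holds a) ; (holds (inj₂ b)) → inj₂ (holds b) })
                (λ { (inj₁ (holds a)) → holds (inj₁ a) ; (inj₂ (holds b)) → holds (inj₂ b) })

  neg-holds : Holds I (neg φ) ⇔ (¬ Holds I φ)
  neg-holds = mk⇔ (λ (holds ¬a) (holds a) → ¬a a) (λ ¬h → holds (λ a → ¬h (holds a)))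

  ⊕-holds : Holds I (φ ⊕' ψ) ⇔ (Holds I φ ⊻ Holds I ψ)
  ⊕-holds = ⇔-trans ∨-holds (⇔-trans ∧-holds (⇔-id _ ×-⇔ neg-holds)
                         ⊎-⇔ ⇔-trans ∧-holds (neg-holds ×-⇔ ⇔-id _))

  ∃-holds : ∀ {x} → Holds I (ex x φ) ⇔ (∃ λ b → T (dom b) × Holds (I [ x ↦ b ]) φ)
  ∃-holds = mk⇔ (λ (holds (b , d , h)) → b , d , holds h) (λ (b , d , holds h) → holds (b , d , h))

  ∀-holds : ∀ {x} → Holds I (all' x φ) ⇔ (∀ b → T (dom b) → Holds (I [ x ↦ b ]) φ)
  ∀-holds {I} {φ} {x} = mk⇔
    (λ (holds h) b d → holds (to (¬∃¬⇔∀ λ b → stable (I [ x ↦ b ]) φ) h b d))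
    (λ f → holds (from (¬∃¬⇔∀ λ b → stable (I [ x ↦ b ]) φ) λ b d → Holds.evidence (f b d)))

  ⋁-holds : ∀ {φs} → Holds I (⋁ φs) ⇔ Any (Holds I) φs
  ⋁-holds {φs = []}     = mk⇔ (λ (holds ¬refl) → ⊥-elim (¬refl refl)) (λ ())
  ⋁-holds {φs = φ ∷ φs} = ⇔-trans ∨-holds (⇔-trans (⇔-id _ ⊎-⇔ ⋁-holds) (↔⇒⇔ (Anyₚ.∷↔ _)))

  ⋀-holds : ∀ {φs} → Holds I (⋀ φs) ⇔ All (Holds I) φs
  ⋀-holds {φs = []}     = mk⇔ (λ _ → []) (λ _ → holds refl)
  ⋀-holds {φs = φ ∷ φs} = ⇔-trans ∧-holds (mk⇔ (λ (h , hs) → h ∷ to ⋀-holds hs)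
                                                (λ { (h ∷ hs) → h , from ⋀-holds hs }))

GridClause : Set
GridClause = GridPred × GridPred × GridPred × GridPred × Fin 2

-- (p , q , r , s , i) stands for  p(x) ∧ q(y) ∧ r(x) ∧ s(y) ∧ x ∼(i,i) y
horClauses verClauses : List GridClause
horClauses = (H₀ , H₁ , V₀ , V₀ , zero) ∷ (H₁ , H₀ , V₀ , V₀ , suc zero)
           ∷ (H₀ , H₁ , V₁ , V₁ , zero) ∷ (H₁ , H₀ , V₁ , V₁ , suc zero) ∷ []
verClauses = (H₀ , H₀ , V₀ , V₁ , zero) ∷ (H₁ , H₁ , V₀ , V₁ , zero)
           ∷ (H₀ , H₀ , V₁ , V₀ , suc zero) ∷ (H₁ , H₁ , V₁ , V₀ , suc zero) ∷ []

module GridSteps {X : Set} (gp : GridPred → X → Bool) where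

  Matches : (Fin 2 → X → ℕ) → GridClause → X → X → Set
  Matches v (p , q , r , s , i) x y =
    T (gp p x) × T (gp q y) × T (gp r x) × T (gp s y) × v i x ≡ v i y

  Step : List GridClause → (Fin 2 → X → ℕ) → X → X → Set
  Step cs v x y = Any (λ c → Matches v c x y) cs

  Hor Ver : (Fin 2 → X → ℕ) → X → X → Set
  Hor = Step horClauses
  Ver = Step verClauses

  module _ {cs : List GridClause} {v : Fin 2 → X → ℕ} {x y : X} where

    step-map : ∀ {w} → (∀ i → v i x ≡ v i y → w i x ≡ w i y) → Step cs v x y → Step cs w x y
    step-map f = Any.map λ { {_ , _ , _ , _ , i} (a , b , c , d , e) → a , b , c , d , f i e }

    step-link : Step cs v x y → ∃ λ i → v i x ≡ v i y
    step-link s with (_ , _ , _ , _ , i) , (_ , _ , _ , _ , e) ← Any.satisfied s = i , e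

Γ₀-refl : ∀ i → T (Γ₀ i i)
Γ₀-refl zero       = _
Γ₀-refl (suc zero) = _

module GridFormulas (𝒟 : DominoSystem) where
  open Formulas 𝒟
  open Connectives {PredD 𝒟} {Γ₀}

  clause : GridClause → Var → Var → F
  clause (p , q , r , s , i) x y = g p x ∧' g q y ∧' g r x ∧' g s y ∧' sim i i (Γ₀-refl i) x y

  clauses : List GridClause → Var → Var → F
  clauses []            x y = false'
  clauses (c ∷ [])      x y = clause c x y
  clauses (c ∷ c' ∷ cs) x y = clause c x y ∨' clauses (c' ∷ cs) x y

  module Semantics {n : ℕ} (dom : Fin n → Bool) (P : PredD 𝒟 → Fin n → Bool)
                   (v : Fin 2 → Fin n → ℕ) where
    open Satisfaction {PredD 𝒟} {Γ₀} n dom P v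
    open GridSteps (λ σ → P (inj₁ σ))

    private variable
      I : Var → Fin n
      x y : Var

    clause-holds : ∀ {c} → Holds I (clause c x y) ⇔ Matches v c (I x) (I y)
    clause-holds {c = _ , _ , _ , _ , _} = mk⇔
      (λ h → let holds a , h = to ∧-holds h ; holds b , h = to ∧-holds h
                 holds c , h = to ∧-holds h ; holds d , holds e = to ∧-holds h
             in a , b , c , d , e)
      (λ (a , b , c , d , e) → from ∧-holds (holds a , from ∧-holds (holds b ,
                                 from ∧-holds (holds c , from ∧-holds (holds d , holds e)))))

    clauses-holds : ∀ cs → Holds I (clauses cs x y) ⇔ Step cs v (I x) (I y)
    clauses-holds []            = mk⇔ (λ (holds ¬refl) → ⊥-elim (¬refl refl)) (λ ())
    clauses-holds (c ∷ [])      = mk⇔ (here ∘ to clause-holds)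
                                      (λ { (here m) → from clause-holds m ; (there ()) })
    clauses-holds (c ∷ c' ∷ cs) =
      ⇔-trans ∨-holds (⇔-trans (clause-holds ⊎-⇔ clauses-holds (c' ∷ cs)) (↔⇒⇔ (Anyₚ.∷↔ _)))

    hor-holds : Holds I (φH x y) ⇔ Hor v (I x) (I y)
    hor-holds = clauses-holds horClauses

    ver-holds : Holds I (φV x y) ⇔ Ver v (I x) (I y)
    ver-holds = clauses-holds verClauses

module Neighbourhood {Pred : Set} (Γ : DataRels) (𝔄 : DataStr Pred) where
  open DataStr 𝔄 using (size)

  Elem : Set
  Elem = Fin (suc size)

  -- Records for the same reason as Holds.
  record Reach (r : ℕ) (u w : Vertex (suc size)) : Set where
    constructor reached
    field path : T (reach Γ 𝔄 r u w)

  record InBall (r : ℕ) (a : Elem) (w : Vertex (suc size)) : Set where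
    constructor ball
    field inside : T (inBall Γ 𝔄 r a w)

  Near : ℕ → Elem → Elem → Set
  Near r a b = ∀ i → InBall r a (b , i)

  private variable
    r : ℕ
    a b c : Elem
    i j : Fin 2
    u w w' : Vertex (suc size)

  any-vertex : ∀ {n} {Q : Vertex n → Set} {b i} → Q (b , i) → Any Q (vertices n)
  any-vertex {Q = Q} {b} {i} q = Anyₚ.concatMap⁺ _ (Anyₚ.tabulate⁺ b (copy i q))
    where
    copy : ∀ i → Q (b , i) → Any Q ((b , zero) ∷ (b , suc zero) ∷ [])
    copy zero       = here
    copy (suc zero) = there ∘ here

  reach-refl : Reach 0 u u
  reach-refl {b , i} = reached (from (T-∧ {eqFin b b}) (eqFin-refl b , eqFin-refl i))

  reach-suc : Reach r u w → Reach (suc r) u w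
  reach-suc {r} {u} {w} (reached t) = reached (from (T-∨ {reach Γ 𝔄 r u w}) (inj₁ t))

  reach-edge : Reach r u w → T (edge Γ 𝔄 w w') → Reach (suc r) u w'
  reach-edge {r} {u} {w@(b , i)} {w'} (reached t) e = reached (from (T-∨ {reach Γ 𝔄 r u w'})
    (inj₂ (Anyₚ.any⁺ (λ z → reach Γ 𝔄 r u z ∧ edge Γ 𝔄 z w')
            (any-vertex {b = b} {i} (from (T-∧ {reach Γ 𝔄 r u w}) (t , e))))))

  inBall⇔ : InBall r a w ⇔ (Reach r (a , zero) w ⊎ Reach r (a , suc zero) w)
  inBall⇔ {r} {a} {w} = mk⇔
    (λ (ball t) → Sum.map reached reached (to (T-∨ {reach Γ 𝔄 r (a , zero) w}) t))
    (λ h → ball (from (T-∨ {reach Γ 𝔄 r (a , zero) w}) (Sum.map Reach.path Reach.path h)))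

  inBall-suc : InBall r a w → InBall (suc r) a w
  inBall-suc = from inBall⇔ ∘ Sum.map reach-suc reach-suc ∘ to inBall⇔

  inBall-edge : InBall r a w → T (edge Γ 𝔄 w w') → InBall (suc r) a w'
  inBall-edge t e = from inBall⇔ (Sum.map (λ t → reach-edge t e) (λ t → reach-edge t e) (to inBall⇔ t))

  edge-data : ∀ i j → T (Γ i j) → val 𝔄 i b ≡ val 𝔄 j c → T (edge Γ 𝔄 (b , i) (c , j))
  edge-data {b} {c} i j γ e =
    from (T-∨ {eqFin b c ∧ not (eqFin i j)}) (inj₂ (from (T-∧ {Γ i j}) (γ , ℕₚ.≡⇒≡ᵇ _ _ e)))

  edge-switch : ∀ i → T (edge Γ 𝔄 (b , i) (b , toggle i))
  edge-switch {b} i = from (T-∨ {eqFin b b ∧ not (eqFin i (toggle i))})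
    (inj₁ (from (T-∧ {eqFin b b}) (eqFin-refl b , not-eqFin-toggle i)))
    where
    not-eqFin-toggle : ∀ i → T (not (eqFin i (toggle i)))
    not-eqFin-toggle zero       = _
    not-eqFin-toggle (suc zero) = _

  inBall-switch : InBall r a (b , i) → Near (suc r) a b
  inBall-switch {i = i} t j with i Fin.≟ j
  ... | yes refl = inBall-suc t
  ... | no i≢j   = subst (λ j → InBall _ _ (_ , j)) (toggle-≢ i≢j) (inBall-edge t (edge-switch i))

  near-self : Near 0 a a
  near-self zero       = from inBall⇔ (inj₁ reach-refl)
  near-self (suc zero) = from inBall⇔ (inj₂ reach-refl)

  near-suc : Near r a b → Near (suc r) a b
  near-suc nb i = inBall-suc (nb i)

  near-data : ∀ i → T (Γ i i) → Near r a b → val 𝔄 i b ≡ val 𝔄 i c → Near (2 + r) a c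
  near-data i γ nb e = inBall-switch (inBall-edge (nb i) (edge-data i i γ e))

  inBall-dom : InBall r a (b , i) → T (viewDom Γ 𝔄 r a b)
  inBall-dom {i = zero}     (ball t) = from T-∨ (inj₁ t)
  inBall-dom {r} {a} {b} {suc zero} (ball t) = from (T-∨ {inBall Γ 𝔄 r a (b , zero)}) (inj₂ t)

  near-dom : Near r a b → T (viewDom Γ 𝔄 r a b)
  near-dom nb = inBall-dom (nb zero)

  val≤valBound : val 𝔄 i b ℕ.≤ valBound 𝔄
  val≤valBound {i} {b} = ℕₚ.≤-trans (below i) (∈⇒≤sum (∈-map⁺ _ (∈-allFin b)))
    where
    below : ∀ i → val 𝔄 i b ℕ.≤ DataStr.f₁ 𝔄 b + DataStr.f₂ 𝔄 b
    below zero       = ℕₚ.m≤m+n _ _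
    below (suc zero) = ℕₚ.m≤n+m _ _

  val<fresh : val 𝔄 i b ℕ.< fresh 𝔄 j c
  val<fresh {i} {b} = ℕ.s≤s (ℕₚ.≤-trans (val≤valBound {i} {b}) (ℕₚ.m≤m+n _ _))

  fresh-injective : fresh 𝔄 i b ≡ fresh 𝔄 i c → b ≡ c
  fresh-injective {b = b} {c} e = Finₚ.toℕ-injective (ℕₚ.*-cancelˡ-≡ (toℕ b) (toℕ c) 2
    (ℕₚ.+-cancelʳ-≡ _ _ _ (ℕₚ.+-cancelˡ-≡ (suc (valBound 𝔄)) _ _ e)))

  viewVal-inBall : InBall r a (b , i) → viewVal Γ 𝔄 r a i b ≡ val 𝔄 i b
  viewVal-inBall {r} {a} {b} {i} (ball t) with inBall Γ 𝔄 r a (b , i)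
  ... | true = refl

  -- Fresh values are pairwise distinct and exceed every value of 𝔄: the view adds no links.
  viewVal-reflects : ∀ i → viewVal Γ 𝔄 r a i b ≡ viewVal Γ 𝔄 r a i c → val 𝔄 i b ≡ val 𝔄 i c
  viewVal-reflects {r} {a} {b} {c} i e with inBall Γ 𝔄 r a (b , i) | inBall Γ 𝔄 r a (c , i)
  ... | true  | true  = e
  ... | true  | false = ⊥-elim (ℕₚ.<⇒≢ (val<fresh {i = i} {b} {i} {c}) e)
  ... | false | true  = ⊥-elim (ℕₚ.<⇒≢ (val<fresh {i = i} {c} {i} {b}) (sym e))
  ... | false | false = cong (val 𝔄 i) (fresh-injective {i = i} e)

  near-transfer : ∀ i → T (Γ i i) → Near r a b → val 𝔄 i b ≡ val 𝔄 i c →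
                  viewVal Γ 𝔄 (suc r) a i b ≡ viewVal Γ 𝔄 (suc r) a i c
  near-transfer {r} {a} {b} {c} i γ nb e = begin
    viewVal Γ 𝔄 (suc r) a i b  ≡⟨ viewVal-inBall (inBall-suc (nb i)) ⟩
    val 𝔄 i b                  ≡⟨ e ⟩
    val 𝔄 i c                  ≡⟨ viewVal-inBall (inBall-edge (nb i) (edge-data i i γ e)) ⟨
    viewVal Γ 𝔄 (suc r) a i c  ∎
    where open ≡-Reasoning

module Locality (𝒟 : DominoSystem) (𝔄 : DataStr (PredD 𝒟)) where
  open DominoSystem 𝒟 using (k; HD; VD)
  open DataStr 𝔄 using (P)
  open Neighbourhood Γ₀ 𝔄 hiding (Elem)
  open Neighbourhood Γ₀ 𝔄 public using (Elem)
  open Formulas 𝒟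
  open Connectives {PredD 𝒟} {Γ₀}
  open RConnectives {PredD 𝒟} {Γ₀} {3} using (allʳ)
  open GridSteps (λ σ → P (inj₁ σ))
  open GridFormulas 𝒟

  GP : GridPred → Elem → Set
  GP σ a = T (P (inj₁ σ) a)

  Tile : Fin k → Elem → Set
  Tile d a = T (P (inj₂ d) a)

  TilePair : (Fin k → Fin k → Bool) → Elem → Elem → Set
  TilePair rel a b = ∃₂ λ d d' → T (rel d d') × Tile d a × Tile d' b

  Horizontal Vertical : Elem → Elem → Set
  Horizontal = Hor (val 𝔄)
  Vertical   = Ver (val 𝔄)

  private variable
    cs : List GridClause
    r : ℕ
    a b c : Elem

  step-reflect : Step cs (viewVal Γ₀ 𝔄 r a) b c → Step cs (val 𝔄) b c
  step-reflect {r = r} {a = a} = step-map (viewVal-reflects {r} {a})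

  step-transfer : Near r a b → Step cs (val 𝔄) b c → Step cs (viewVal Γ₀ 𝔄 (suc r) a) b c
  step-transfer nb = step-map λ i → near-transfer i (Γ₀-refl i) nb

  step-near : Near r a b → Step cs (val 𝔄) b c → Near (2 + r) a c
  step-near nb s with i , e ← step-link s = near-data i (Γ₀-refl i) nb e

  step-dom : Near r a b → Step cs (val 𝔄) b c → T (viewDom Γ₀ 𝔄 (suc r) a c)
  step-dom nb s with i , e ← step-link s = inBall-dom (inBall-edge (nb i) (edge-data i i (Γ₀-refl i) e))

  -- φgridD is the conjunction of ∀x.⟨ψ⟩³ₓ for these six ψ
  squareψ successorsψ parityψ tileψ horTilesψ verTilesψ : F
  squareψ     = all' vy (all' vx' (all' vy' ((φH vx vy ∧' φV vx vx' ∧' φV vy vy') ⇒' φH vx' vy')))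
  successorsψ = ex vy (φH vx vy) ∧' ex vy (φV vx vy)
  parityψ     = (g H₀ vx ⊕' g H₁ vx) ∧' (g V₀ vx ⊕' g V₁ vx)
  tileψ       = ⋁ (map (λ d → dom' d vx ∧' ⋀ (concatMap (λ d' → if eqFin d d' then []
                                                          else neg (dom' d vx ∧' dom' d' vx) ∷ [])
                                                  (allFin k)))
                       (allFin k))
  horTilesψ   = all' vy (φH vx vy ⇒' pairsDisj HD vx vy)
  verTilesψ   = all' vy (φV vx vy ⇒' pairsDisj VD vx vy)

  centre : Elem → Var → Elem
  centre a = (λ _ → zero) [ vx ↦ a ]

  near₂ : Near 2 a a
  near₂ = near-suc (near-suc near-self)

  module AtCentre (a : Elem) where
    open Satisfaction {PredD 𝒟} {Γ₀} _ (viewDom Γ₀ 𝔄 3 a) P (viewVal Γ₀ 𝔄 3 a) public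
    open Semantics (viewDom Γ₀ 𝔄 3 a) P (viewVal Γ₀ 𝔄 3 a)

    unview : ∀ {cs b c} → Step cs (viewVal Γ₀ 𝔄 3 a) b c → Step cs (val 𝔄) b c
    unview = step-reflect {r = 3} {a = a}

    square-local : Holds (centre a) squareψ ⇔
                   (∀ {y x' y'} → Horizontal a y → Vertical a x' → Vertical y y' → Horizontal x' y')
    square-local = mk⇔ global local
      where
      global : Holds (centre a) squareψ →
               ∀ {y x' y'} → Horizontal a y → Vertical a x' → Vertical y y' → Horizontal x' y'
      global h {y} {x'} {y'} hy hx' hy' =
        let ny  = step-near near-self hy
            nx' = step-near near-self hx'
            h'  = to ∀-holds (to ∀-holds (to ∀-holds h y (near-dom (near-suc ny)))
                                         x' (near-dom (near-suc nx')))
                             y' (step-dom ny hy')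
        in unview (to hor-holds (to ⇒-holds h'
             (from ∧-holds (from hor-holds (step-transfer near₂ hy) ,
              from ∧-holds (from ver-holds (step-transfer near₂ hx') ,
                            from ver-holds (step-transfer ny hy'))))))

      local : (∀ {y x' y'} → Horizontal a y → Vertical a x' → Vertical y y' → Horizontal x' y') →
              Holds (centre a) squareψ
      local sq = from ∀-holds λ _ _ → from ∀-holds λ _ _ → from ∀-holds λ _ _ →
                 from ⇒-holds λ h →
        let hy , h'   = to ∧-holds h
            hx' , hy' = to ∧-holds h'
            Hx'       = unview (to ver-holds hx')
        in from hor-holds (step-transfer (step-near near-self Hx')
             (sq (unview (to hor-holds hy)) Hx' (unview (to ver-holds hy'))))

    successor-local : ∀ cs → Holds (centre a) (ex vy (clauses cs vx vy)) ⇔ ∃ (Step cs (val 𝔄) a)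
    successor-local cs = ⇔-trans ∃-holds (mk⇔
      (λ (y , _ , h) → y , unview (to (clauses-holds cs) h))
      (λ (y , s) → y , near-dom (near-suc (step-near near-self s)) ,
                   from (clauses-holds cs) (step-transfer near₂ s)))

    successors-local : Holds (centre a) successorsψ ⇔ (∃ (Horizontal a) × ∃ (Vertical a))
    successors-local = ⇔-trans ∧-holds (successor-local horClauses ×-⇔ successor-local verClauses)

    parity-local : Holds (centre a) parityψ ⇔ ((GP H₀ a ⊻ GP H₁ a) × (GP V₀ a ⊻ GP V₁ a))
    parity-local = ⇔-trans ∧-holds (⇔-trans ⊕-holds (⊻-cong atom-holds atom-holds)
                                ×-⇔ ⇔-trans ⊕-holds (⊻-cong atom-holds atom-holds))

    pairs-holds : ∀ {I x y} rel → Holds I (pairsDisj rel x y) ⇔ TilePair rel (I x) (I y)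
    pairs-holds rel =
      ⇔-trans ⋁-holds (⇔-trans Any-concatMap (⇔-trans Any-allFin (∃-cong (
      ⇔-trans Any-concatMap (⇔-trans Any-allFin (∃-cong (
      ⇔-trans (Any-singleton-if (rel _ _)) (⇔-id _ ×-⇔ ⇔-trans ∧-holds (atom-holds ×-⇔ atom-holds)))))))))

    tiles-local : ∀ cs rel → Holds (centre a) (all' vy (clauses cs vx vy ⇒' pairsDisj rel vx vy)) ⇔
                  (∀ {y} → Step cs (val 𝔄) a y → TilePair rel a y)
    tiles-local cs rel = mk⇔
      (λ h {y} s → to (pairs-holds rel)
         (to ⇒-holds (to ∀-holds h y (near-dom (near-suc (step-near near-self s))))
                     (from (clauses-holds cs) (step-transfer near₂ s))))
      (λ f → from ∀-holds λ _ _ → from ⇒-holds λ h →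
         from (pairs-holds rel) (f (unview (to (clauses-holds cs) h))))

    tile-local : Holds (centre a) tileψ ⇔ ∃! _≡_ (λ d → Tile d a)
    tile-local =
      ⇔-trans ⋁-holds (⇔-trans (mk⇔ Anyₚ.map⁻ Anyₚ.map⁺) (⇔-trans Any-allFin (⇔-trans
        (∃-cong (⇔-trans ∧-holds (atom-holds ×-⇔ ⇔-trans ⋀-holds exclusive)))
        (exclusive⇔∃! Fin._≟_))))
      where
      exclusive : ∀ {d} → All (Holds (centre a)) (concatMap (λ d' → if eqFin d d' then []
                                                  else neg (dom' d vx ∧' dom' d' vx) ∷ []) (allFin k))
                  ⇔ (∀ d' → d ≢ d' → ¬ (Tile d a × Tile d' a))
      exclusive {d} = ⇔-trans All-concatMap (⇔-trans All-allFin (∀-cong λ d' →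
        ⇔-trans (All-singleton-unless (eqFin d d'))
                (→-cong (¬-cong T-eqFin)
                        (⇔-trans neg-holds (¬-cong (⇔-trans ∧-holds (atom-holds ×-⇔ atom-holds)))))))

  record IsTiledGrid : Set where
    constructor tiledGrid
    field
      square     : ∀ x {y x' y'} → Horizontal x y → Vertical x x' → Vertical y y' → Horizontal x' y'
      successors : ∀ x → ∃ (Horizontal x) × ∃ (Vertical x)
      parity     : ∀ x → (GP H₀ x ⊻ GP H₁ x) × (GP V₀ x ⊻ GP V₁ x)
      tile       : ∀ x → ∃! _≡_ (λ d → Tile d x)
      hor-tiles  : ∀ x {y} → Horizontal x y → TilePair HD x y
      ver-tiles  : ∀ x {y} → Vertical x y → TilePair VD x y

  everywhere⇔ : ∀ ψ {Q : Elem → Set} → (∀ a → AtCentre.Holds a (centre a) ψ ⇔ Q a) →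
                evalR 𝔄 (λ _ → zero) (allʳ vx (loc ψ vx)) ⇔ (∀ a → Q a)
  everywhere⇔ ψ local = ⇔-trans (mk⇔ (λ h a ¬s → h (a , ¬s)) (λ f (a , ¬s) → f a ¬s))
                                 (∀-cong λ a → ⇔-trans (AtCentre.¬¬-holds a) (local a))

  ⊨φgridD⇔ : 𝔄 ⊨ φgridD ⇔ IsTiledGrid
  ⊨φgridD⇔ = ⇔-trans
    (∧ʳ⇔ (∧ʳ⇔ (everywhere⇔ squareψ AtCentre.square-local)
              (∧ʳ⇔ (everywhere⇔ successorsψ AtCentre.successors-local)
                   (everywhere⇔ parityψ AtCentre.parity-local)))
         (∧ʳ⇔ (everywhere⇔ tileψ AtCentre.tile-local)
              (∧ʳ⇔ (everywhere⇔ horTilesψ λ a → AtCentre.tiles-local a horClauses HD)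
                   (everywhere⇔ verTilesψ λ a → AtCentre.tiles-local a verClauses VD))))
    (mk⇔ (λ ((sq , su , pa) , (ti , ht , vt)) → tiledGrid sq su pa ti ht vt)
         (λ (tiledGrid sq su pa ti ht vt) → (sq , su , pa) , (ti , ht , vt)))
    where
    -- every conjunct of φgridD is a negation, hence stable
    ∧ʳ⇔ : ∀ {X Y A B : Set} → (¬ X) ⇔ A → (¬ Y) ⇔ B → (¬ (¬ ¬ X ⊎ ¬ ¬ Y)) ⇔ (A × B)
    ∧ʳ⇔ e₁ e₂ = ⇔-trans (¬⊎¬⇔× negated-stable negated-stable) (e₁ ×-⇔ e₂)

  tiled⇒periodic : IsTiledGrid → HasPeriodicTiling 𝒟
  tiled⇒periodic g = Product.map₂ (tiling ∘ₘ_)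
    (squares⇒grid-morphism (proj₁ ∘ successors) (proj₂ ∘ successors) (square _))
    where
    open IsTiledGrid g

    tileOf : Elem → Fin k
    tileOf x = proj₁ (tile x)

    pair⇒tileOf : ∀ {rel x y} → TilePair rel x y → T (rel (tileOf x) (tileOf y))
    pair⇒tileOf {rel} {x} {y} (d , d' , r , t , t') =
      subst₂ (λ d d' → T (rel d d')) (sym (proj₂ (proj₂ (tile x)) t))
                                     (sym (proj₂ (proj₂ (tile y)) t')) r

    tiling : Morphism (record { Carrier = Elem ; R₁ = Horizontal ; R₂ = Vertical }) (asBiBinary 𝒟)
    tiling = record { π = tileOf ; pres₁ = λ x _ h → pair⇒tileOf (hor-tiles x h)
                                 ; pres₂ = λ x _ v → pair⇒tileOf (ver-tiles x v) }

module Torus (m' : ℕ) where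

  M : ℕ
  M = suc m'

  next : Fin M → Fin M
  next i = Fin.fromℕ< (m%n<n (suc (toℕ i)) M)

  toℕ-next : ∀ i → toℕ (next i) ≡ suc (toℕ i) % M
  toℕ-next i = Finₚ.toℕ-fromℕ< _

  next-injective : ∀ {i j} → next i ≡ next j → i ≡ j
  next-injective {i} {j} e = Finₚ.toℕ-injective (begin
    toℕ i                              ≡⟨ unwind (toℕ i) (Finₚ.toℕ<n i) ⟩
    (suc (toℕ i) % M + m' % M) % M     ≡⟨ cong (λ l → (l + m' % M) % M) next-i≡next-j ⟩
    (suc (toℕ j) % M + m' % M) % M     ≡⟨ unwind (toℕ j) (Finₚ.toℕ<n j) ⟨
    toℕ j                              ∎)
    where
    open ≡-Reasoning
    next-i≡next-j : suc (toℕ i) % M ≡ suc (toℕ j) % M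
    next-i≡next-j = trans (sym (toℕ-next i)) (trans (cong toℕ e) (toℕ-next j))

    unwind : ∀ a → a ℕ.< M → a ≡ (suc a % M + m' % M) % M
    unwind a a<M = begin
      a                           ≡⟨ m<n⇒m%n≡m a<M ⟨
      a % M                       ≡⟨ [m+n]%n≡m%n a M ⟨
      (a + M) % M                 ≡⟨ cong (_% M) (ℕₚ.+-suc a m') ⟩
      (suc a + m') % M            ≡⟨ %-distribˡ-+ (suc a) m' M ⟩
      (suc a % M + m' % M) % M    ∎

  Coord : Set
  Coord = Fin 2 × Fin M

  step : Coord → Coord
  step (p , i) = toggle p , next i

  -- half p c = half p c' exactly when c = c' or {c , c'} = {d , step d} with d of parity p
  half : Fin 2 → Coord → Fin M
  half zero       (zero     , i) = next i
  half zero       (suc zero , i) = i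
  half (suc zero) (zero     , i) = i
  half (suc zero) (suc zero , i) = next i

  half-step : ∀ p i → half p (step (p , i)) ≡ half p (p , i)
  half-step zero       i = refl
  half-step (suc zero) i = refl

  half-toggle : ∀ p {i i'} → half p (p , i) ≡ half p (toggle p , i') → i' ≡ next i
  half-toggle zero       e = sym e
  half-toggle (suc zero) e = sym e

  half-injective : ∀ p q {i i'} → half p (q , i) ≡ half p (q , i') → i ≡ i'
  half-injective zero       zero       = next-injective
  half-injective zero       (suc zero) = λ e → e
  half-injective (suc zero) zero       = λ e → e
  half-injective (suc zero) (suc zero) = next-injective

  Cell : Set
  Cell = Coord × Coord

  right up : Cell → Cell
  right (c , d) = step c , d
  up    (c , d) = c , step d

  hpar vpar : Cell → Fin 2
  hpar ((p , _) , _) = p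
  vpar (_ , (q , _)) = q

  cellVal : Fin 2 → Cell → ℕ
  cellVal p (c , d) = toℕ (Fin.combine (half p c) (half p d))

  cellVal-injective : ∀ {p c d c' d'} → cellVal p (c , d) ≡ cellVal p (c' , d') →
                      half p c ≡ half p c' × half p d ≡ half p d'
  cellVal-injective {p} {c} {d} {c'} {d'} e =
    Finₚ.combine-injective (half p c) (half p d) (half p c') (half p d') (Finₚ.toℕ-injective e)

  parityPred : GridPred → Cell → Bool
  parityPred H₀ c = eqFin (hpar c) zero
  parityPred H₁ c = eqFin (hpar c) (suc zero)
  parityPred V₀ c = eqFin (vpar c) zero
  parityPred V₁ c = eqFin (vpar c) (suc zero)

  open GridSteps parityPred

  private
    is : ∀ (a b : Fin 2) → T (eqFin a b) → a ≡ b
    is a b = to (T-eqFin {a = a} {b})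

  module _ {w : Fin 2 → Cell → ℕ} where

    HorParity VerParity : Cell → Cell → Set
    HorParity c c' = hpar c' ≡ toggle (hpar c) × vpar c' ≡ vpar c × w (hpar c) c ≡ w (hpar c) c'
    VerParity c c' = hpar c' ≡ hpar c × vpar c' ≡ toggle (vpar c) × w (vpar c) c ≡ w (vpar c) c'

    hor⇔parity : ∀ {c c'} → Hor w c c' ⇔ HorParity c c'
    hor⇔parity {c} {c'} = mk⇔ hor⇒parity (parity⇒hor c c')
      where
      hor⇒parity : ∀ {c c'} → Hor w c c' → HorParity c c'
      hor⇒parity {(p , _) , (q , _)} {(p' , _) , (q' , _)} (here (hp , hp' , hq , hq' , e))
        with refl ← is p zero hp | refl ← is p' (suc zero) hp'
           | refl ← is q zero hq | refl ← is q' zero hq' = refl , refl , e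
      hor⇒parity {(p , _) , (q , _)} {(p' , _) , (q' , _)} (there (here (hp , hp' , hq , hq' , e)))
        with refl ← is p (suc zero) hp | refl ← is p' zero hp'
           | refl ← is q zero hq | refl ← is q' zero hq' = refl , refl , e
      hor⇒parity {(p , _) , (q , _)} {(p' , _) , (q' , _)} (there (there (here (hp , hp' , hq , hq' , e))))
        with refl ← is p zero hp | refl ← is p' (suc zero) hp'
           | refl ← is q (suc zero) hq | refl ← is q' (suc zero) hq' = refl , refl , e
      hor⇒parity {(p , _) , (q , _)} {(p' , _) , (q' , _)} (there (there (there (here (hp , hp' , hq , hq' , e)))))
        with refl ← is p (suc zero) hp | refl ← is p' zero hp'
           | refl ← is q (suc zero) hq | refl ← is q' (suc zero) hq' = refl , refl , e

      parity⇒hor : ∀ c c' → HorParity c c' → Hor w c c'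
      parity⇒hor ((zero     , _) , (zero     , _)) _ (refl , refl , e) = here (_ , _ , _ , _ , e)
      parity⇒hor ((suc zero , _) , (zero     , _)) _ (refl , refl , e) = there (here (_ , _ , _ , _ , e))
      parity⇒hor ((zero     , _) , (suc zero , _)) _ (refl , refl , e) = there (there (here (_ , _ , _ , _ , e)))
      parity⇒hor ((suc zero , _) , (suc zero , _)) _ (refl , refl , e) = there (there (there (here (_ , _ , _ , _ , e))))

    ver⇔parity : ∀ {c c'} → Ver w c c' ⇔ VerParity c c'
    ver⇔parity {c} {c'} = mk⇔ ver⇒parity (parity⇒ver c c')
      where
      ver⇒parity : ∀ {c c'} → Ver w c c' → VerParity c c'
      ver⇒parity {(p , _) , (q , _)} {(p' , _) , (q' , _)} (here (hp , hp' , hq , hq' , e))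
        with refl ← is p zero hp | refl ← is p' zero hp'
           | refl ← is q zero hq | refl ← is q' (suc zero) hq' = refl , refl , e
      ver⇒parity {(p , _) , (q , _)} {(p' , _) , (q' , _)} (there (here (hp , hp' , hq , hq' , e)))
        with refl ← is p (suc zero) hp | refl ← is p' (suc zero) hp'
           | refl ← is q zero hq | refl ← is q' (suc zero) hq' = refl , refl , e
      ver⇒parity {(p , _) , (q , _)} {(p' , _) , (q' , _)} (there (there (here (hp , hp' , hq , hq' , e))))
        with refl ← is p zero hp | refl ← is p' zero hp'
           | refl ← is q (suc zero) hq | refl ← is q' zero hq' = refl , refl , e
      ver⇒parity {(p , _) , (q , _)} {(p' , _) , (q' , _)} (there (there (there (here (hp , hp' , hq , hq' , e)))))
        with refl ← is p (suc zero) hp | refl ← is p' (suc zero) hp'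
           | refl ← is q (suc zero) hq | refl ← is q' zero hq' = refl , refl , e

      parity⇒ver : ∀ c c' → VerParity c c' → Ver w c c'
      parity⇒ver ((zero     , _) , (zero     , _)) _ (refl , refl , e) = here (_ , _ , _ , _ , e)
      parity⇒ver ((suc zero , _) , (zero     , _)) _ (refl , refl , e) = there (here (_ , _ , _ , _ , e))
      parity⇒ver ((zero     , _) , (suc zero , _)) _ (refl , refl , e) = there (there (here (_ , _ , _ , _ , e)))
      parity⇒ver ((suc zero , _) , (suc zero , _)) _ (refl , refl , e) = there (there (there (here (_ , _ , _ , _ , e))))

  hor⇔right : ∀ {c c'} → Hor cellVal c c' ⇔ c' ≡ right c
  hor⇔right {c} {c'} = ⇔-trans hor⇔parity (mk⇔ (parity⇒right c c') (right⇒parity c c'))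
    where
    parity⇒right : ∀ c c' → HorParity {cellVal} c c' → c' ≡ right c
    parity⇒right ((p , i) , (q , j)) ((_ , i') , (_ , j')) (refl , refl , e)
      with hᵢ , hⱼ ← cellVal-injective {p} {p , i} {q , j} {toggle p , i'} {q , j'} e =
      cong₂ (λ a b → (toggle p , a) , (q , b)) (half-toggle p hᵢ) (sym (half-injective p q hⱼ))

    right⇒parity : ∀ c c' → c' ≡ right c → HorParity {cellVal} c c'
    right⇒parity ((p , i) , (q , j)) _ refl =
      refl , refl , cong (λ h → toℕ (Fin.combine h (half p (q , j)))) (sym (half-step p i))

  ver⇔up : ∀ {c c'} → Ver cellVal c c' ⇔ c' ≡ up c
  ver⇔up {c} {c'} = ⇔-trans ver⇔parity (mk⇔ (parity⇒up c c') (up⇒parity c c'))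
    where
    parity⇒up : ∀ c c' → VerParity {cellVal} c c' → c' ≡ up c
    parity⇒up ((p , i) , (q , j)) ((_ , i') , (_ , j')) (refl , refl , e)
      with hᵢ , hⱼ ← cellVal-injective {q} {p , i} {q , j} {p , i'} {toggle q , j'} e =
      cong₂ (λ a b → (p , a) , (toggle q , b)) (sym (half-injective q p hᵢ)) (half-toggle q hⱼ)

    up⇒parity : ∀ c c' → c' ≡ up c → VerParity {cellVal} c c'
    up⇒parity ((p , i) , (q , j)) _ refl =
      refl , refl , cong (λ h → toℕ (Fin.combine (half q (p , i)) h)) (sym (half-step q j))

module TilingModel (𝒟 : DominoSystem) (m' : ℕ) (τ : Morphism (Grid m') (asBiBinary 𝒟)) where
  open DominoSystem 𝒟 using (k; HD; VD)
  open Torus m'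

  K : ℕ
  K = (2 * M) * (2 * M)

  encode : Cell → Fin K
  encode ((p , i) , (q , j)) = Fin.combine (Fin.combine p i) (Fin.combine q j)

  decode : Fin K → Cell
  decode = Product.map (Fin.remQuot M) (Fin.remQuot M) ∘ Fin.remQuot (2 * M)

  decode-encode : ∀ c → decode (encode c) ≡ c
  decode-encode ((p , i) , (q , j)) =
    trans (cong (Product.map (Fin.remQuot M) (Fin.remQuot M))
                (Finₚ.remQuot-combine (Fin.combine p i) (Fin.combine q j)))
          (cong₂ _,_ (Finₚ.remQuot-combine p i) (Finₚ.remQuot-combine q j))

  tileAt : Cell → Fin k
  tileAt ((_ , i) , (_ , j)) = Morphism.π τ (i , j)

  right-tiles : ∀ c → T (HD (tileAt c) (tileAt (right c)))
  right-tiles ((_ , i) , (_ , j)) = Morphism.pres₁ τ (i , j) (next i , j) (toℕ-next i , refl)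

  up-tiles : ∀ c → T (VD (tileAt c) (tileAt (up c)))
  up-tiles ((_ , i) , (_ , j)) = Morphism.pres₂ τ (i , j) (i , next j) (refl , toℕ-next j)

  cellPred : PredD 𝒟 → Cell → Bool
  cellPred (inj₁ σ) = parityPred σ
  cellPred (inj₂ d) c = eqFin d (tileAt c)

  𝔐 : DataStr (PredD 𝒟)
  𝔐 = record { size = ℕ.pred K ; P = λ σ → cellPred σ ∘ decode
             ; f₁ = cellVal zero ∘ decode ; f₂ = cellVal (suc zero) ∘ decode }

  open Locality 𝒟 𝔐
  open GridSteps (λ σ → DataStr.P 𝔐 (inj₁ σ)) using (Step; step-map)

  private
    -- val 𝔐 i computes by cases on i, so it meets cellVal i ∘ decode only after splitting i
    on-cells : ∀ {cs x y} →
               Step cs (val 𝔐) x y ⇔ GridSteps.Step parityPred cs cellVal (decode x) (decode y)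
    on-cells {x = x} {y} = mk⇔
      (step-map {x = x} {y} {w = λ i → cellVal i ∘ decode} λ { zero e → e ; (suc zero) e → e })
      (step-map {v = λ i → cellVal i ∘ decode} {x} {y} λ { zero e → e ; (suc zero) e → e })

  horizontal⇔right : ∀ {x y} → Horizontal x y ⇔ decode y ≡ right (decode x)
  horizontal⇔right = ⇔-trans on-cells hor⇔right

  vertical⇔up : ∀ {x y} → Vertical x y ⇔ decode y ≡ up (decode x)
  vertical⇔up = ⇔-trans on-cells ver⇔up

  parity-bit : ∀ (p : Fin 2) → T (eqFin p zero) ⊻ T (eqFin p (suc zero))
  parity-bit zero       = inj₁ (_ , λ ())
  parity-bit (suc zero) = inj₂ ((λ ()) , _)

  𝔐-tiled : IsTiledGrid
  𝔐-tiled = tiledGrid square successors parity tile hor-tiles ver-tiles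
    where
    parity : ∀ x → (GP H₀ x ⊻ GP H₁ x) × (GP V₀ x ⊻ GP V₁ x)
    parity x = parity-bit (hpar (decode x)) , parity-bit (vpar (decode x))

    square : ∀ x {y x' y'} → Horizontal x y → Vertical x x' → Vertical y y' → Horizontal x' y'
    square x {y} {x'} {y'} h v v' = from horizontal⇔right (begin
      decode y'             ≡⟨ to vertical⇔up v' ⟩
      up (decode y)         ≡⟨ cong up (to horizontal⇔right h) ⟩
      right (up (decode x)) ≡⟨ cong right (to vertical⇔up v) ⟨
      right (decode x')     ∎)
      where open ≡-Reasoning

    successors : ∀ x → ∃ (Horizontal x) × ∃ (Vertical x)
    successors x = (encode (right (decode x)) , from horizontal⇔right (decode-encode _))
                 , (encode (up (decode x)) , from vertical⇔up (decode-encode _))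

    tile : ∀ x → ∃! _≡_ (λ d → Tile d x)
    tile x = tileAt (decode x) , eqFin-refl (tileAt (decode x)) , λ t → sym (to T-eqFin t)

    hor-tiles : ∀ x {y} → Horizontal x y → TilePair HD x y
    hor-tiles x {y} h = tileAt (decode x) , tileAt (decode y) ,
      subst (T ∘ HD (tileAt (decode x)) ∘ tileAt) (sym (to horizontal⇔right h)) (right-tiles (decode x)) ,
      eqFin-refl (tileAt (decode x)) , eqFin-refl (tileAt (decode y))

    ver-tiles : ∀ x {y} → Vertical x y → TilePair VD x y
    ver-tiles x {y} v = tileAt (decode x) , tileAt (decode y) ,
      subst (T ∘ VD (tileAt (decode x)) ∘ tileAt) (sym (to vertical⇔up v)) (up-tiles (decode x)) ,
      eqFin-refl (tileAt (decode x)) , eqFin-refl (tileAt (decode y))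

proposition3p25 : (𝒟 : DominoSystem) →
    HasPeriodicTiling 𝒟 ⇔ Satisfiable (Formulas.φgridD 𝒟)
proposition3p25 𝒟 = mk⇔
  (λ (m' , τ) → let open TilingModel 𝒟 m' τ in 𝔐 , from (Locality.⊨φgridD⇔ 𝒟 𝔐) 𝔐-tiled)
  (λ (𝔄 , 𝔄⊨φ) → let open Locality 𝒟 𝔄 in tiled⇒periodic (to ⊨φgridD⇔ 𝔄⊨φ))
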